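{- There is an absolute constant $C$ such that for every $k$ and every resolving broadcast $f$ of $F_k$ with $f(v_k)\ge k$, we have $\sum_{v\in V(F_k)}f(v)\ge f(v_k)+2k-C$ (i.e. $\sum_{v}f(v)\ge f(v_k)+2k-O(1)$).
   Context: For $k\ge0$, $L_k$ is the path $v_0,v_1,\dots,v_k$, and $F_k$ is the tree obtained from $L_k$ by attaching, for each $1\le i\le k$, a path on $i$ vertices with one endpoint joined by an edge to $v_i$. $d(u,v)$ is graph distance and $d_m(u,v)=\min\{d(u,v),m+1\}$. A function $f:V(G)\to\mathbb{Z}_{\ge0}$ is a resolving broadcast of $G$ if for any distinct $x,y$ there is $z$ with $f(z)>0$ and $d_{f(z)}(x,z)\ne d_{f(z)}(y,z)$. -}

module Defs where

open import Data.Nat using (ℕ; zero; suc; _+_; _≤_; _⊓_)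
open import Data.Fin using (Fin; toℕ; fromℕ)
open import Data.List using (List; map; _++_; concatMap)
open import Data.Nat.ListAction using (sum)
open import Data.List using (allFin)
open import Data.Sum using (_⊎_)
open import Data.Product using (_×_; ∃-syntax)
open import Relation.Binary.PropositionalEquality using (_≡_; _≢_)

-- Vertices of F_k:
--   spine a        is v_a           (0 ≤ a ≤ k)
--   leg i j        is the vertex at distance (toℕ j + 1) from v_{toℕ i + 1}
--                  on the pendant path of (toℕ i + 1) vertices attached at v_{toℕ i + 1}
data V (k : ℕ) : Set where
  spine : Fin (suc k) → V k
  leg   : (i : Fin k) → Fin (suc (toℕ i)) → V k

vk : (k : ℕ) → V k
vk k = spine (fromℕ k)

-- Edges of F_k (one orientation each)
data Edge {k : ℕ} : V k → V k → Set where
  spine-spine : (a b : Fin (suc k)) → toℕ b ≡ suc (toℕ a) → Edge (spine a) (spine b)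
  spine-leg   : (a : Fin (suc k)) (i : Fin k) (j : Fin (suc (toℕ i))) →
                toℕ a ≡ suc (toℕ i) → toℕ j ≡ 0 → Edge (spine a) (leg i j)
  leg-leg     : (i : Fin k) (j j' : Fin (suc (toℕ i))) →
                toℕ j' ≡ suc (toℕ j) → Edge (leg i j) (leg i j')

Adj : {k : ℕ} → V k → V k → Set
Adj u v = Edge u v ⊎ Edge v u

data Walk {k : ℕ} : V k → V k → ℕ → Set where
  here : {u : V k} → Walk u u 0
  step : {u w v : V k} {n : ℕ} → Adj u w → Walk w v n → Walk u v (suc n)

IsDist : {k : ℕ} → V k → V k → ℕ → Set
IsDist u v n = Walk u v n × (∀ m → Walk u v m → n ≤ m)

trunc : ℕ → ℕ → ℕ
trunc m d = d ⊓ suc m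

Resolving : (k : ℕ) → (V k → ℕ) → Set
Resolving k f =
  (x y : V k) → x ≢ y →
  ∃[ z ] (0 Data.Nat.< f z ×
          (∀ dx dy → IsDist x z dx → IsDist y z dy → trunc (f z) dx ≢ trunc (f z) dy))

-- list of all vertices of F_k, each exactly once
allV : (k : ℕ) → List (V k)
allV k = map spine (allFin (suc k)) ++ concatMap (λ i → map (leg i) (allFin (suc (toℕ i)))) (allFin k)

cost : (k : ℕ) → (V k → ℕ) → ℕ
cost k f = sum (map f (allV k))

module Submission where

-- A vertex has coordinates (column, height) in the comb ℕ × ℕ, and
-- the graph distance of F_k is the comb distance δ of the coordinates (δ-isDist):
-- δ changes by at most one along an edge, and explicit walks attain it.  For t ≤ m+1 the vertices x = (m+1, t) and y = (m+2, t+1) are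
-- equidistant from every vertex except those in the columns < m+1 (nearer to x)
-- and those in columns m+1, m+2.  So a broadcasting vertex resolving this rung
-- either reaches x from the left or sits in column m+1 or m+2 with strength at
-- least the distance between t and its height (rungResolver, rungResolved).  Order the vertices by level (v_a has level a+1, its pendant path
-- level a).  By induction over pairs of levels, the first n levels carry total
-- strength ≥ 2n - 40: levels m+1, m+2 add ≥ 4, either via one vertex reaching far
-- along the spine, or, when no such vertex exists, because each of the m+2 rungs
-- between columns m+1, m+2 needs a resolver and a band vertex of strength r
-- resolves at most 3r rungs (band-pays).  A second invariant bounds how far
-- along the spine a vertex of the first n levels reaches.
-- Finally v_k has level k+1, so f(v_k) comes on top of the first k levels.

open import Defs
open import Data.Nat using (ℕ; _+_; _*_; _≤_)
open import Data.Product using (∃-syntax)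

open import Data.Nat using (zero; suc; _∸_; _<_; _⊓_; z≤n; s≤s; s≤s⁻¹; ∣_-_∣; _≟_; _≤?_)
open import Data.Nat.Properties
open import Data.Fin as Fin using (Fin; toℕ; fromℕ<)
open import Data.Fin.Properties using (toℕ-injective; toℕ-fromℕ<; toℕ-fromℕ; toℕ<n)
open import Data.Sum using (inj₁; inj₂)
open import Data.Product using (Σ; _×_; _,_; proj₁; proj₂)
open import Data.List using (List; []; _∷_; map; downFrom; allFin)
open import Data.List.Membership.Propositional.Properties
  using (∈-map⁺; ∈-++⁺ˡ; ∈-++⁺ʳ; ∈-concatMap⁺; ∈-allFin; ∈-downFrom⁻)
open import Data.List.Relation.Unary.Any as Any using (here; there; any?; satisfied)
open import Data.List.Membership.Propositional using (_∈_; lose)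
open import Data.Nat.ListAction using (sum)
open import Algebra.Properties.CommutativeSemigroup +-commutativeSemigroup using (interchange)
open import Function using (_∘_)
open import Relation.Unary using (Decidable)
open import Data.Nat.Tactic.RingSolver using (solve; solve-∀)
open import Relation.Nullary using (Dec; yes; no; ¬_; _×-dec_)
open import Relation.Binary.Definitions using (tri<; tri≈; tri>)
open import Relation.Nullary.Negation using (contradiction)
open import Relation.Binary.PropositionalEquality
  using (_≡_; _≢_; refl; sym; trans; cong; cong₂; module ≡-Reasoning)

private variable
  k : ℕ
  u v w : V k

-- Coordinates: v_a sits at (a , 0); the j-th vertex (from 0) of the pendant
-- path hanging at v_{i+1} sits at (i+1 , j+1).  The foot of a vertex is the spine
-- vertex in its column.
foot : V k → Fin (suc k)
foot (spine a) = a
foot (leg i j) = Fin.suc i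

column : V k → ℕ
column v = toℕ (foot v)

height : V k → ℕ
height (spine a) = 0
height (leg i j) = suc (toℕ j)

-- Distance in the infinite comb ℕ × ℕ (spine ℕ × {0}, a vertical path on each
-- spine point): along the tooth if the columns agree, otherwise through the spine.
combDist : ℕ → ℕ → ℕ → ℕ → ℕ
combDist a h b g with a ≟ b
... | yes _ = ∣ h - g ∣
... | no  _ = h + ∣ a - b ∣ + g

combDist-same : ∀ a b h g → a ≡ b → combDist a h b g ≡ ∣ h - g ∣
combDist-same a b h g a≡b with a ≟ b
... | yes _  = refl
... | no a≢b = contradiction a≡b a≢b

combDist-apart : ∀ a b h g → a ≢ b → combDist a h b g ≡ h + ∣ a - b ∣ + g
combDist-apart a b h g a≢b with a ≟ b
... | yes a≡b = contradiction a≡b a≢b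
... | no _    = refl

δ : V k → V k → ℕ
δ u v = combDist (column u) (height u) (column v) (height v)

-- δ is a lower bound for the length of walks: it changes by at most one along an
-- edge.  Near x y says that x and y differ by at most one.
Near : ℕ → ℕ → Set
Near x y = x ≤ suc y × y ≤ suc x

near-sym : ∀ {x y} → Near x y → Near y x
near-sym (p , q) = q , p

near-suc : ∀ x → Near x (suc x)
near-suc x = m≤n⇒m≤1+n (n≤1+n x) , ≤-refl

near-+ʳ : ∀ {x y} c → Near x y → Near (x + c) (y + c)
near-+ʳ c (p , q) = +-monoˡ-≤ c p , +-monoˡ-≤ c q

∣-∣-near-suc : ∀ a b → Near ∣ a - b ∣ ∣ suc a - b ∣
∣-∣-near-suc zero    zero          = near-suc 0
∣-∣-near-suc zero    (suc zero)    = near-sym (near-suc 0)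
∣-∣-near-suc zero    (suc (suc b)) = near-sym (near-suc (suc b))
∣-∣-near-suc (suc a) zero          = near-suc (suc a)
∣-∣-near-suc (suc a) (suc b)       = ∣-∣-near-suc a b

∣suc-∣≡1 : ∀ a → ∣ suc a - a ∣ ≡ 1
∣suc-∣≡1 zero    = refl
∣suc-∣≡1 (suc a) = ∣suc-∣≡1 a

combDist-near-column : ∀ a b g → Near (combDist a 0 b g) (combDist (suc a) 0 b g)
combDist-near-column a b g with a ≟ b | suc a ≟ b
... | yes refl | yes sa≡a = contradiction sa≡a 1+n≢n
... | yes refl | no _     rewrite ∣suc-∣≡1 a = near-suc ∣ 0 - g ∣
... | no _     | yes refl rewrite ∣-∣-comm a (suc a) | ∣suc-∣≡1 a = near-sym (near-suc g)
... | no _     | no _     = near-+ʳ g (∣-∣-near-suc a b)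

combDist-near-height : ∀ a h b g → Near (combDist a h b g) (combDist a (suc h) b g)
combDist-near-height a h b g with a ≟ b
... | yes _ = ∣-∣-near-suc h g
... | no  _ = near-+ʳ g (near-+ʳ ∣ a - b ∣ (near-suc h))

δ-edge : Edge u w → ∀ v → Near (δ u v) (δ w v)
δ-edge (spine-spine a _ b≡1+a) v rewrite b≡1+a =
  combDist-near-column (toℕ a) (column v) (height v)
δ-edge (spine-leg _ i _ a≡1+i j≡0) v rewrite a≡1+i | j≡0 =
  combDist-near-height (suc (toℕ i)) 0 (column v) (height v)
δ-edge (leg-leg i j _ j′≡1+j) v rewrite j′≡1+j =
  combDist-near-height (suc (toℕ i)) (suc (toℕ j)) (column v) (height v)

δ-adj : Adj u w → ∀ v → δ u v ≤ suc (δ w v)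
δ-adj (inj₁ e) v = proj₁ (δ-edge e v)
δ-adj (inj₂ e) v = proj₁ (near-sym (δ-edge e v))

δ-self : (u : V k) → δ u u ≡ 0
δ-self u = trans (combDist-same (column u) (column u) (height u) (height u) refl) (∣n-n∣≡0 (height u))

δ-≤-walk : ∀ {n} → Walk u v n → δ u v ≤ n
δ-≤-walk {u = u} here = ≤-reflexive (δ-self u)
δ-≤-walk {v = v} (step adj walk) = ≤-trans (δ-adj adj v) (s≤s (δ-≤-walk walk))

snoc : ∀ {n} → Walk u v n → Adj v w → Walk u w (suc n)
snoc here         adj = step adj here
snoc (step e wlk) adj = step e (snoc wlk adj)

adj-sym : Adj u w → Adj w u
adj-sym (inj₁ e) = inj₂ e
adj-sym (inj₂ e) = inj₁ e

reverse : ∀ {n} → Walk u v n → Walk v u n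
reverse here         = here
reverse (step e wlk) = snoc (reverse wlk) (adj-sym e)

_⊕_ : ∀ {m n} → Walk u v m → Walk v w n → Walk u w (m + n)
here       ⊕ wlk′ = wlk′
step e wlk ⊕ wlk′ = step e (wlk ⊕ wlk′)

recast : ∀ {m n} → m ≡ n → Walk u v m → Walk u v n
recast refl wlk = wlk

module Line {N : ℕ} (p : Fin (suc N) → V k)
            (p-adj : ∀ a b → toℕ b ≡ suc (toℕ a) → Adj (p a) (p b)) where

  walkUp : ∀ a b d → toℕ b ≡ toℕ a + d → Walk (p a) (p b) d
  walkUp a b zero    b≡a with toℕ-injective (trans b≡a (+-identityʳ (toℕ a)))
  ... | refl = here
  walkUp a b (suc d) b≡a+1+d =
    step (p-adj a next (toℕ-fromℕ< a<N)) (walkUp next b d b≡next+d)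
    where
    a<N : suc (toℕ a) < suc N
    a<N = ≤-<-trans (≤-trans (m≤m+n (suc (toℕ a)) d)
                             (≤-reflexive (trans (sym (+-suc (toℕ a) d)) (sym b≡a+1+d))))
                    (toℕ<n b)
    next : Fin (suc N)
    next = fromℕ< a<N
    b≡next+d : toℕ b ≡ toℕ next + d
    b≡next+d = trans b≡a+1+d (trans (+-suc (toℕ a) d) (cong (_+ d) (sym (toℕ-fromℕ< a<N))))

  walk : ∀ a b → Walk (p a) (p b) ∣ toℕ a - toℕ b ∣
  walk a b with ≤-total (toℕ a) (toℕ b)
  ... | inj₁ a≤b = recast (sym (m≤n⇒∣m-n∣≡n∸m a≤b)) (walkUp a b _ (sym (m+[n∸m]≡n a≤b)))
  ... | inj₂ b≤a = recast (sym (m≤n⇒∣n-m∣≡n∸m b≤a)) (reverse (walkUp b a _ (sym (m+[n∸m]≡n b≤a))))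

spineWalk : (a b : Fin (suc k)) → Walk (spine a) (spine b) ∣ toℕ a - toℕ b ∣
spineWalk = Line.walk spine (λ a b e → inj₁ (spine-spine a b e))

-- the tooth at v_{i+1}, including its foot as point 0
tooth : (i : Fin k) → Fin (suc (suc (toℕ i))) → V k
tooth i Fin.zero    = spine (Fin.suc i)
tooth i (Fin.suc j) = leg i j

toothWalk : (i : Fin k) (a b : Fin (suc (suc (toℕ i)))) →
            Walk (tooth i a) (tooth i b) ∣ toℕ a - toℕ b ∣
toothWalk i = Line.walk (tooth i) tooth-adj
  where
  tooth-adj : ∀ a b → toℕ b ≡ suc (toℕ a) → Adj (tooth i a) (tooth i b)
  tooth-adj Fin.zero    (Fin.suc j)  e = inj₁ (spine-leg (Fin.suc i) i j refl (suc-injective e))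
  tooth-adj (Fin.suc j) (Fin.suc j′) e = inj₁ (leg-leg i j j′ (suc-injective e))

toFoot : (u : V k) → Walk u (spine (foot u)) (height u)
toFoot (spine a) = here
toFoot (leg i j) = toothWalk i (Fin.suc j) Fin.zero

sameColumnWalk : (u v : V k) → column u ≡ column v → Walk u v ∣ height u - height v ∣
sameColumnWalk (spine a) (spine b) e with toℕ-injective e
... | refl = here
sameColumnWalk (spine a) (leg i j) e with toℕ-injective e
... | refl = toothWalk i Fin.zero (Fin.suc j)
sameColumnWalk (leg i j) (spine a) e with toℕ-injective e
... | refl = toothWalk i (Fin.suc j) Fin.zero
sameColumnWalk (leg i j) (leg i′ j′) e with toℕ-injective (suc-injective e)
... | refl = toothWalk i (Fin.suc j) (Fin.suc j′)

δ-walk : (u v : V k) → Walk u v (δ u v)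
δ-walk u v = byColumns (column u ≟ column v)
  where
  byColumns : Dec (column u ≡ column v) → Walk u v (δ u v)
  byColumns (yes same) = recast (sym (combDist-same (column u) (column v) (height u) (height v) same)) (sameColumnWalk u v same)
  byColumns (no apart) = recast (sym (combDist-apart (column u) (column v) (height u) (height v) apart))
                           ((toFoot u ⊕ spineWalk (foot u) (foot v)) ⊕ reverse (toFoot v))

δ-isDist : (u v : V k) → IsDist u v (δ u v)
δ-isDist u v = δ-walk u v , λ _ → δ-≤-walk


separated⇒inRange : ∀ r {d₁ d₂} → trunc r d₁ ≢ trunc r d₂ → d₁ ≤ d₂ → d₁ ≤ r
separated⇒inRange r {d₁} {d₂} sep d₁≤d₂ with d₁ ≤? r
... | yes d₁≤r = d₁≤r
... | no  d₁≰r = contradiction (trans (m≥n⇒m⊓n≡n r<d₁) (sym (m≥n⇒m⊓n≡n (<-≤-trans r<d₁ d₁≤d₂)))) sep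
  where r<d₁ = ≰⇒> d₁≰r

∣-∣≤+ : ∀ x y → ∣ x - y ∣ ≤ x + y
∣-∣≤+ x y = ≤-trans (∣m-n∣≤m⊔n x y) (m⊔n≤m+n x y)

∣-∣-pred : ∀ {b a} → b < a → ∣ b - a ∣ ≡ suc ∣ suc b - a ∣
∣-∣-pred {zero}  {suc a} _         = refl
∣-∣-pred {suc b} {suc a} (s≤s b<a) = ∣-∣-pred b<a

RungSeparated : (m t a h r : ℕ) → Set
RungSeparated m t a h r =
  trunc r (combDist (suc m) t a h) ≢ trunc r (combDist (suc (suc m)) (suc t) a h)

separated-cong : ∀ {r d₁ d₂ e₁ e₂} → d₁ ≡ e₁ → d₂ ≡ e₂ →
                 trunc r d₁ ≢ trunc r d₂ → trunc r e₁ ≢ trunc r e₂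
separated-cong refl refl sep = sep

-- from an earlier column, x is nearer than y, so x must be in range
separated-before : ∀ {m t a h r} → a < suc m → RungSeparated m t a h r →
                   t + (suc m ∸ a) + h ≤ r
separated-before {m} {t} {a} {h} {r} a<1+m sep =
  separated⇒inRange r (separated-cong toX toY sep)
    (+-monoˡ-≤ h (+-mono-≤ (n≤1+n t) (∸-monoˡ-≤ a (n≤1+n (suc m)))))
  where
  toX : combDist (suc m) t a h ≡ t + (suc m ∸ a) + h
  toX = trans (combDist-apart (suc m) a t h (>⇒≢ a<1+m))
              (cong (λ e → t + e + h) (m≤n⇒∣n-m∣≡n∸m (<⇒≤ a<1+m)))
  toY : combDist (suc (suc m)) (suc t) a h ≡ suc t + (suc (suc m) ∸ a) + h
  toY = trans (combDist-apart (suc (suc m)) a (suc t) h (>⇒≢ (m<n⇒m<1+n a<1+m)))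
              (cong (λ e → suc t + e + h) (m≤n⇒∣n-m∣≡n∸m (m≤n⇒m≤1+n (<⇒≤ a<1+m))))

-- in x's column, x is nearer than y
separated-columnX : ∀ {m t h r} → RungSeparated m t (suc m) h r → ∣ t - h ∣ ≤ r
separated-columnX {m} {t} {h} {r} sep =
  separated⇒inRange r (separated-cong (combDist-same (suc m) (suc m) t h refl) toY sep)
    (≤-trans (∣-∣≤+ t h) (+-monoˡ-≤ h (≤-trans (n≤1+n t) (m≤m+n (suc t) 1))))
  where
  toY : combDist (suc (suc m)) (suc t) (suc m) h ≡ suc t + 1 + h
  toY = trans (combDist-apart (suc (suc m)) (suc m) (suc t) h 1+n≢n)
              (cong (λ e → suc t + e + h) (∣suc-∣≡1 (suc m)))

toX-fromColumnY : ∀ m t h → combDist (suc m) t (suc (suc m)) h ≡ t + 1 + h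
toX-fromColumnY m t h =
  trans (combDist-apart (suc m) (suc (suc m)) t h (<⇒≢ (n<1+n (suc m))))
        (cong (λ e → t + e + h) (trans (∣-∣-comm (suc m) (suc (suc m))) (∣suc-∣≡1 (suc m))))

unseparated-spineY : ∀ {m t r} → ¬ RungSeparated m t (suc (suc m)) 0 r
unseparated-spineY {m} {t} {r} sep = sep (cong (trunc r) (begin
  combDist (suc m) t (suc (suc m)) 0         ≡⟨ toX-fromColumnY m t 0 ⟩
  t + 1 + 0                                  ≡⟨ trans (+-identityʳ (t + 1)) (+-comm t 1) ⟩
  suc t                                      ≡⟨ sym (combDist-same (suc (suc m)) (suc (suc m)) (suc t) 0 refl) ⟩
  combDist (suc (suc m)) (suc t) (suc (suc m)) 0 ∎))
  where open ≡-Reasoning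

-- above the spine in y's column, y is nearer than x
separated-columnY : ∀ {m t h r} → RungSeparated m t (suc (suc m)) (suc h) r → ∣ t - h ∣ ≤ r
separated-columnY {m} {t} {h} {r} sep =
  separated⇒inRange r (λ e → sep′ (sym e)) (≤-trans (∣-∣≤+ t h) (+-mono-≤ (m≤m+n t 1) (n≤1+n h)))
  where
  sep′ : trunc r (t + 1 + suc h) ≢ trunc r ∣ t - h ∣
  sep′ = separated-cong (toX-fromColumnY m t (suc h))
                        (combDist-same (suc (suc m)) (suc (suc m)) (suc t) (suc h) refl) sep

-- beyond y's column, both are reached through the spine at the same distance
unseparated-beyond : ∀ {m t a h r} → suc (suc m) < a → ¬ RungSeparated m t a h r
unseparated-beyond {m} {t} {a} {h} {r} 2+m<a sep = sep (cong (trunc r) (trans toX (sym toY)))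
  where
  toX : combDist (suc m) t a h ≡ t + suc ∣ suc (suc m) - a ∣ + h
  toX = trans (combDist-apart (suc m) a t h (<⇒≢ (<⇒≤ 2+m<a)))
              (cong (λ e → t + e + h) (∣-∣-pred (<⇒≤ 2+m<a)))
  toY : combDist (suc (suc m)) (suc t) a h ≡ t + suc ∣ suc (suc m) - a ∣ + h
  toY = trans (combDist-apart (suc (suc m)) a (suc t) h (<⇒≢ 2+m<a)) (cong (_+ h) (sym (+-suc t _)))

data RungResolver (m t a h r : ℕ) : Set where
  before    : a ≤ m → t + (suc m ∸ a) + h ≤ r → RungResolver m t a h r
  inColumnX : a ≡ suc m → ∣ t - h ∣ ≤ r → RungResolver m t a h r
  inColumnY : a ≡ suc (suc m) → ∀ h′ → h ≡ suc h′ → ∣ t - h′ ∣ ≤ r → RungResolver m t a h r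

rungResolver : ∀ m t a h r → RungSeparated m t a h r → RungResolver m t a h r
rungResolver m t a h r sep with <-cmp a (suc m)
... | tri< a<1+m _ _ = before (s≤s⁻¹ a<1+m) (separated-before {m} {t} {a} {h} {r} a<1+m sep)
... | tri≈ _ refl _  = inColumnX refl (separated-columnX {m} {t} {h} {r} sep)
... | tri> _ _ 1+m<a with <-cmp a (suc (suc m)) | h
...   | tri< a<2+m _ _ | _      = contradiction (s≤s⁻¹ a<2+m) (<⇒≱ 1+m<a)
...   | tri> _ _ 2+m<a | h₀     = contradiction sep (unseparated-beyond {m} {t} {a} {h₀} {r} 2+m<a)
...   | tri≈ _ refl _  | zero   = contradiction sep (unseparated-spineY {m} {t} {r})
...   | tri≈ _ refl _  | suc h′ = inColumnY refl h′ refl (separated-columnY {m} {t} {h′} {r} sep)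

vertexAt : ∀ a h → h ≤ a → a ≤ k → Σ (V k) λ v → column v ≡ a × height v ≡ h
vertexAt a zero _ a≤k = spine (fromℕ< (s≤s a≤k)) , toℕ-fromℕ< (s≤s a≤k) , refl
vertexAt (suc a) (suc h) (s≤s h≤a) a<k =
  leg i (fromℕ< h<1+i) , cong suc (toℕ-fromℕ< a<k) , cong suc (toℕ-fromℕ< h<1+i)
  where
  i = fromℕ< a<k
  h<1+i : h < suc (toℕ i)
  h<1+i = s≤s (≤-trans h≤a (≤-reflexive (sym (toℕ-fromℕ< a<k))))

rungResolved : (f : V k → ℕ) → Resolving k f → ∀ m t → suc (suc m) ≤ k → t ≤ suc m →
               ∃[ z ] (0 < f z × RungResolver m t (column z) (height z) (f z))
rungResolved f resolving m t m+2≤k t≤m+1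
  with vertexAt (suc m) t t≤m+1 (≤-trans (n≤1+n (suc m)) m+2≤k)
     | vertexAt (suc (suc m)) (suc t) (s≤s t≤m+1) m+2≤k
... | x , cx , hx | y , cy , hy
  with resolving x y (λ x≡y → 1+n≢n (trans (sym cy) (trans (cong column (sym x≡y)) cx)))
... | z , f[z]>0 , separates = z , f[z]>0 , rungResolver m t (column z) (height z) (f z) sep
  where
  δx : δ x z ≡ combDist (suc m) t (column z) (height z)
  δx = cong₂ (λ a h → combDist a h (column z) (height z)) cx hx
  δy : δ y z ≡ combDist (suc (suc m)) (suc t) (column z) (height z)
  δy = cong₂ (λ a h → combDist a h (column z) (height z)) cy hy
  sep : RungSeparated m t (column z) (height z) (f z)
  sep = separated-cong δx δy (separates (δ x z) (δ y z) (δ-isDist x z) (δ-isDist y z))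

sumOf : {X : Set} → List X → (X → ℕ) → ℕ
sumOf xs g = sum (map g xs)

module _ {X : Set} where

  sumOf-zero : (xs : List X) → sumOf xs (λ _ → 0) ≡ 0
  sumOf-zero []       = refl
  sumOf-zero (_ ∷ xs) = sumOf-zero xs

  sumOf-+ : (xs : List X) (g₁ g₂ : X → ℕ) →
            sumOf xs (λ x → g₁ x + g₂ x) ≡ sumOf xs g₁ + sumOf xs g₂
  sumOf-+ []       g₁ g₂ = refl
  sumOf-+ (x ∷ xs) g₁ g₂ = trans (cong (g₁ x + g₂ x +_) (sumOf-+ xs g₁ g₂))
                                 (interchange (g₁ x) (g₂ x) (sumOf xs g₁) (sumOf xs g₂))

  sumOf-* : (xs : List X) (c : ℕ) (g : X → ℕ) → sumOf xs (λ x → c * g x) ≡ c * sumOf xs g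
  sumOf-* []       c g = sym (*-zeroʳ c)
  sumOf-* (x ∷ xs) c g = trans (cong (c * g x +_) (sumOf-* xs c g)) (sym (*-distribˡ-+ c (g x) (sumOf xs g)))

  sumOf-mono : (xs : List X) {g₁ g₂ : X → ℕ} → (∀ {x} → x ∈ xs → g₁ x ≤ g₂ x) →
               sumOf xs g₁ ≤ sumOf xs g₂
  sumOf-mono []       le = z≤n
  sumOf-mono (x ∷ xs) le = +-mono-≤ (le (here refl)) (sumOf-mono xs (le ∘ there))

  sumOf-point : {xs : List X} (g : X → ℕ) {x : X} → x ∈ xs → g x ≤ sumOf xs g
  sumOf-point {_ ∷ xs} g (here refl) = m≤m+n _ (sumOf xs g)
  sumOf-point {y ∷ xs} g (there x∈xs) = ≤-trans (sumOf-point g x∈xs) (m≤n+m _ (g y))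

sumOf-comm : {X Y : Set} (xs : List X) (ys : List Y) (c : X → Y → ℕ) →
             sumOf xs (λ x → sumOf ys (c x)) ≡ sumOf ys (λ y → sumOf xs (λ x → c x y))
sumOf-comm []       ys c = sym (sumOf-zero ys)
sumOf-comm (x ∷ xs) ys c = trans (cong (sumOf ys (c x) +_) (sumOf-comm xs ys c))
                                 (sym (sumOf-+ ys (c x) (λ y → sumOf xs (λ x′ → c x′ y))))

_if_ : {P : Set} → ℕ → Dec P → ℕ
n if yes _ = n
n if no  _ = 0

if-yes : {P : Set} {n : ℕ} → P → (d : Dec P) → n if d ≡ n
if-yes p (yes _) = refl
if-yes p (no ¬p) = contradiction p ¬p

if-≤ : {P : Set} {n : ℕ} (d : Dec P) → n if d ≤ n
if-≤ (yes _) = ≤-refl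
if-≤ (no  _) = z≤n

if-mono : {P Q : Set} {n : ℕ} → (P → Q) → (dp : Dec P) (dq : Dec Q) → n if dp ≤ n if dq
if-mono p⇒q (yes p) dq = ≤-reflexive (sym (if-yes (p⇒q p) dq))
if-mono p⇒q (no  _) dq = z≤n

if-disjoint : {P Q R : Set} {n : ℕ} → (P → ¬ Q) → (P → R) → (Q → R) →
              (dp : Dec P) (dq : Dec Q) (dr : Dec R) → n if dp + n if dq ≤ n if dr
if-disjoint p⇒¬q p⇒r q⇒r (yes p) (yes q) dr = contradiction q (p⇒¬q p)
if-disjoint p⇒¬q p⇒r q⇒r (yes p) (no _)  dr =
  ≤-reflexive (trans (+-identityʳ _) (sym (if-yes (p⇒r p) dr)))
if-disjoint p⇒¬q p⇒r q⇒r (no _)  dq      dr = if-mono q⇒r dq dr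

sumOf-disjoint : {X : Set} (xs : List X) (g : X → ℕ) {P Q R : X → Set}
                 (P? : Decidable P) (Q? : Decidable Q) (R? : Decidable R) →
                 (∀ {x} → P x → ¬ Q x) → (∀ {x} → P x → R x) → (∀ {x} → Q x → R x) →
                 sumOf xs (λ x → g x if P? x) + sumOf xs (λ x → g x if Q? x) ≤
                 sumOf xs (λ x → g x if R? x)
sumOf-disjoint xs g P? Q? R? p⇒¬q p⇒r q⇒r = begin
  sumOf xs (λ x → g x if P? x) + sumOf xs (λ x → g x if Q? x)
    ≡⟨ sym (sumOf-+ xs _ _) ⟩
  sumOf xs (λ x → g x if P? x + g x if Q? x)
    ≤⟨ sumOf-mono xs (λ {x} _ → if-disjoint p⇒¬q p⇒r q⇒r (P? x) (Q? x) (R? x)) ⟩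
  sumOf xs (λ x → g x if R? x) ∎
  where open ≤-Reasoning

inInterval? : ∀ lo hi t → Dec (lo ≤ t × t ≤ hi)
inInterval? lo hi t = (lo ≤? t) ×-dec (t ≤? hi)

intervalCount : ∀ N lo hi → sumOf (downFrom N) (λ t → 1 if inInterval? lo hi t) ≤ suc hi ∸ lo
intervalCount N lo hi = ≤-trans (counted N) (∸-monoˡ-≤ lo (m⊓n≤n N (suc hi)))
  where
  counted : ∀ N → sumOf (downFrom N) (λ t → 1 if inInterval? lo hi t) ≤ N ⊓ suc hi ∸ lo
  counted zero    = z≤n
  counted (suc N) with inInterval? lo hi N
  ... | yes (lo≤N , N≤hi) = begin
    suc (sumOf (downFrom N) (λ t → 1 if inInterval? lo hi t)) ≤⟨ s≤s (counted N) ⟩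
    suc (N ⊓ suc hi ∸ lo)                                      ≡⟨ cong (λ e → suc (e ∸ lo)) (m≤n⇒m⊓n≡m (m≤n⇒m≤1+n N≤hi)) ⟩
    suc (N ∸ lo)                                               ≡⟨ sym (+-∸-assoc 1 lo≤N) ⟩
    suc N ∸ lo                                                 ≡⟨ cong (_∸ lo) (sym (m≤n⇒m⊓n≡m (s≤s N≤hi))) ⟩
    suc N ⊓ suc hi ∸ lo                                        ∎
    where open ≤-Reasoning
  ... | no _ = ≤-trans (counted N) (∸-monoˡ-≤ lo (⊓-monoˡ-≤ (suc hi) (n≤1+n N)))

count-downFrom : ∀ N → sumOf (downFrom N) (λ _ → 1) ≡ N
count-downFrom zero    = refl
count-downFrom (suc N) = cong suc (count-downFrom N)

ball⇒interval : ∀ {t c r} → ∣ t - c ∣ ≤ r → c ∸ r ≤ t × t ≤ c + r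
ball⇒interval {t} {c} {r} close =
  m≤n+o⇒m∸n≤o c r (≤-trans (m≤n+∣n-m∣ c t) (≤-trans (+-monoʳ-≤ t close) (≤-reflexive (+-comm t r))))
  , ≤-trans (m≤n+∣n-m∣ t c) (+-monoʳ-≤ c (≤-trans (≤-reflexive (∣-∣-comm c t)) close))

intervalWidth : ∀ c r → suc (c + r) ∸ (c ∸ r) ≤ suc (r + r)
intervalWidth c r = m≤n+o⇒m∸n≤o (suc (c + r)) (c ∸ r) (begin
  suc (c + r)                 ≤⟨ s≤s (+-monoˡ-≤ r (m≤n+m∸n c r)) ⟩
  suc (r + (c ∸ r) + r)       ≡⟨ regroup r (c ∸ r) ⟩
  c ∸ r + suc (r + r)         ∎)
  where
  open ≤-Reasoning
  regroup : ∀ r d → suc (r + d + r) ≡ d + suc (r + r)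
  regroup = solve-∀

1+2r≤3r : ∀ {r} → 1 ≤ r → suc (r + r) ≤ 3 * r
1+2r≤3r {r} 1≤r = begin
  suc (r + r) ≤⟨ +-monoˡ-≤ (r + r) 1≤r ⟩
  r + (r + r) ≡⟨ solve (r ∷ []) ⟩
  3 * r       ∎
  where open ≤-Reasoning


-- Here c, c′ stand for costs of the
-- first levels, f, a, h for the strength, column and height of a vertex.
-- a strong broadcast that is already compensated pays for 2n
strong⇒paid : ∀ {n f a c h} → f + a ≤ c + 24 + h → 2 * n + h ≤ f + a + 13 → 2 * n ≤ c + 37
strong⇒paid {n} {f} {a} {c} {h} compensated strong = +-cancelʳ-≤ h (2 * n) (c + 37) (begin
  2 * n + h       ≤⟨ strong ⟩
  f + a + 13      ≤⟨ +-monoˡ-≤ 13 compensated ⟩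
  c + 24 + h + 13 ≡⟨ solve (c ∷ h ∷ []) ⟩
  c + 37 + h      ∎)
  where open ≤-Reasoning

-- a vertex in a column ≤ m reaching column 2(m+2) - 13 has strength ≥ 4 (m ≥ 19)
strong⇒4≤f : ∀ {m f a h} → a ≤ m → 2 * suc (suc m) + h ≤ f + a + 13 → 19 ≤ m → 4 ≤ f
strong⇒4≤f {m} {f} {a} {h} a≤m strong 19≤m =
  ≤-trans (m≤m+n 4 6) (+-cancelʳ-≤ 13 10 f (≤-trans (+-monoˡ-≤ 4 19≤m) m+4≤f+13))
  where
  open ≤-Reasoning
  m+4≤f+13 : m + 4 ≤ f + 13
  m+4≤f+13 = +-cancelˡ-≤ m (m + 4) (f + 13) (begin
    m + (m + 4)       ≡⟨ solve (m ∷ []) ⟩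
    2 * suc (suc m)   ≤⟨ m≤m+n _ h ⟩
    2 * suc (suc m) + h ≤⟨ strong ⟩
    f + a + 13        ≤⟨ +-monoˡ-≤ 13 (+-monoʳ-≤ f a≤m) ⟩
    f + m + 13        ≡⟨ solve (f ∷ m ∷ []) ⟩
    m + (f + 13)      ∎)

paid-by-4 : ∀ {m c c′} → 2 * m ≤ c + 40 → c + 4 ≤ c′ → 2 * suc (suc m) ≤ c′ + 40
paid-by-4 {m} {c} {c′} paid gain = begin
  2 * suc (suc m) ≡⟨ solve (m ∷ []) ⟩
  2 * m + 4       ≤⟨ +-monoˡ-≤ 4 paid ⟩
  c + 40 + 4      ≡⟨ solve (c ∷ []) ⟩
  c + 4 + 40      ≤⟨ +-monoˡ-≤ 40 gain ⟩
  c′ + 40         ∎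
  where open ≤-Reasoning

-- a vertex of level m+1 or m+2, m ≥ 23, is compensated once its strength is paid
compensated-new : ∀ {m c c′ f a h} → 2 * m ≤ c + 40 → c + f ≤ c′ → a ≤ suc (suc m) → 23 ≤ m →
                  f + a ≤ c′ + 24 + h
compensated-new {m} {c} {c′} {f} {a} {h} paid gain a≤m+2 23≤m = begin
  f + a      ≤⟨ +-monoʳ-≤ f (≤-trans a≤m+2 m+2≤c+24) ⟩
  f + (c + 24) ≡⟨ solve (f ∷ c ∷ []) ⟩
  c + f + 24 ≤⟨ +-monoˡ-≤ 24 gain ⟩
  c′ + 24    ≤⟨ m≤m+n _ h ⟩
  c′ + 24 + h ∎
  where
  open ≤-Reasoning
  m+2≤c+24 : suc (suc m) ≤ c + 24
  m+2≤c+24 = +-cancelʳ-≤ 21 (suc (suc m)) (c + 24) (begin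
    suc (suc m) + 21 ≡⟨ solve (m ∷ []) ⟩
    m + 23          ≤⟨ +-monoʳ-≤ m 23≤m ⟩
    m + m           ≡⟨ solve (m ∷ []) ⟩
    2 * m           ≤⟨ paid ⟩
    c + 40          ≤⟨ +-monoʳ-≤ c (m≤m+n 40 5) ⟩
    c + 45          ≡⟨ solve (c ∷ []) ⟩
    c + 24 + 21     ∎)

-- a vertex in a column a ≤ m that reaches x = (m+1 , t) but not column
-- 2(m+2) - 13 along the spine can only do so for t ≤ (m+2) - 13
early⇒lowRung : ∀ {m t a h r} → t + (suc m ∸ a) + h ≤ r → r + a + 13 < 2 * suc (suc m) + h →
                a ≤ m → t ≤ suc (suc m) ∸ 13
early⇒lowRung {m} {t} {a} {h} {r} reach weak a≤m =
  m+n≤o⇒m≤o∸n t (+-cancelʳ-≤ (suc (suc m) + h) (t + 13) (suc (suc m)) (begin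
    t + 13 + (suc (suc m) + h) ≡⟨ solve (t ∷ m ∷ h ∷ []) ⟩
    suc (t + suc m + h + 13)   ≡⟨ cong (λ e → suc (t + e + h + 13)) (sym (m∸n+n≡m (m≤n⇒m≤1+n a≤m))) ⟩
    suc (t + (s + a) + h + 13) ≡⟨ regroup t s a h ⟩
    suc (t + s + h + a + 13)   ≤⟨ s≤s (+-monoˡ-≤ 13 (+-monoˡ-≤ a reach)) ⟩
    suc (r + a + 13)           ≤⟨ weak ⟩
    2 * suc (suc m) + h        ≡⟨ solve (m ∷ h ∷ []) ⟩
    suc (suc m) + (suc (suc m) + h) ∎))
  where
  open ≤-Reasoning
  s = suc m ∸ a
  regroup : ∀ t s a h → suc (t + (s + a) + h + 13) ≡ suc (t + s + h + a + 13)
  regroup = solve-∀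

-- if n rungs are covered by n - 12 low ones and 3c others, then c ≥ 4
covered⇒4≤c : ∀ {n c} → n ≤ suc (n ∸ 13) + 3 * c → 13 ≤ n → 4 ≤ c
covered⇒4≤c {n} {c} covered 13≤n = *-cancelˡ-≤ 3 (s≤s⁻¹ (+-cancelˡ-≤ (n ∸ 13) 13 (suc (3 * c)) (begin
  n ∸ 13 + 13         ≡⟨ m∸n+n≡m 13≤n ⟩
  n                   ≤⟨ covered ⟩
  suc (n ∸ 13) + 3 * c ≡⟨ sym (+-suc (n ∸ 13) (3 * c)) ⟩
  n ∸ 13 + suc (3 * c) ∎)))
  where open ≤-Reasoning

-- Levels and partial costs.
-- v_a has level a+1 and the pendant path at v_a has level a, so the first
-- n levels are a connected initial piece of F_k.
level : V k → ℕ
level (spine a) = suc (toℕ a)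
level (leg i j) = suc (toℕ i)

column≤level : (v : V k) → column v ≤ level v
column≤level (spine a) = n≤1+n (toℕ a)
column≤level (leg i j) = ≤-refl

level≤1+column : (v : V k) → level v ≤ suc (column v)
level≤1+column (spine a) = ≤-refl
level≤1+column (leg i j) = n≤1+n (suc (toℕ i))

level-vk : level (vk k) ≡ suc k
level-vk {k} = cong suc (toℕ-fromℕ k)

level-offSpine : ∀ {h} (v : V k) → height v ≡ suc h → level v ≡ column v
level-offSpine (leg i j) _ = refl

allV-complete : (v : V k) → v ∈ allV k
allV-complete (spine a) = ∈-++⁺ˡ (∈-map⁺ spine (∈-allFin a))
allV-complete {k} (leg i j) =
  ∈-++⁺ʳ (map spine (allFin (suc k)))
         (∈-concatMap⁺ (λ i′ → map (leg i′) (allFin (suc (toℕ i′))))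
                       (Any.map (λ { refl → ∈-map⁺ (leg i) (∈-allFin j) }) (∈-allFin i)))

module Broadcast (f : V k → ℕ) where

  costUpTo : ℕ → ℕ
  costUpTo n = sumOf (allV k) (λ v → f v if (level v ≤? n))

  costUpTo-point : ∀ {n} z → level z ≤ n → f z ≤ costUpTo n
  costUpTo-point {n} z lz = ≤-trans (≤-reflexive (sym (if-yes lz (level z ≤? n))))
                                    (sumOf-point (λ v → f v if (level v ≤? n)) (allV-complete z))

  costUpTo-mono : ∀ {n n′} → n ≤ n′ → costUpTo n ≤ costUpTo n′
  costUpTo-mono {n} {n′} n≤n′ = sumOf-mono (allV k)
    (λ {v} _ → if-mono (λ lv → ≤-trans lv n≤n′) (level v ≤? n) (level v ≤? n′))

  costUpTo≤cost : ∀ n → costUpTo n ≤ cost k f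
  costUpTo≤cost n = sumOf-mono (allV k) (λ {v} _ → if-≤ (level v ≤? n))

  costUpTo-extend : ∀ {n n′} z → n < level z → level z ≤ n′ → costUpTo n + f z ≤ costUpTo n′
  costUpTo-extend {n} {n′} z n<lz lz≤n′ = begin
    costUpTo n + f z
      ≤⟨ +-monoʳ-≤ (costUpTo n) (≤-trans (≤-reflexive (sym (if-yes refl (level z ≟ level z))))
                                         (sumOf-point (λ v → f v if (level v ≟ level z)) (allV-complete z))) ⟩
    costUpTo n + sumOf (allV k) (λ v → f v if (level v ≟ level z))
      ≤⟨ sumOf-disjoint (allV k) f (λ v → level v ≤? n) (λ v → level v ≟ level z) (λ v → level v ≤? n′)
           (λ lv≤n lv≡lz → <⇒≱ n<lz (≤-trans (≤-reflexive (sym lv≡lz)) lv≤n))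
           (λ lv≤n → ≤-trans lv≤n (≤-trans (<⇒≤ n<lz) lz≤n′))
           (λ lv≡lz → ≤-trans (≤-reflexive lv≡lz) lz≤n′) ⟩
    costUpTo n′ ∎
    where open ≤-Reasoning

  -- The band of columns m+1, m+2: its vertices of level ≤ m+2 are those that can
  -- resolve the rungs between these columns without lying further left.
  InBand : ℕ → V k → Set
  InBand m v = suc m ≤ column v × level v ≤ suc (suc m)

  inBand? : ∀ m v → Dec (InBand m v)
  inBand? m v = (suc m ≤? column v) ×-dec (level v ≤? suc (suc m))

  bandCost : ℕ → ℕ
  bandCost m = sumOf (allV k) (λ v → f v if inBand? m v)

  costUpTo-band : ∀ m → costUpTo m + bandCost m ≤ costUpTo (suc (suc m))
  costUpTo-band m = sumOf-disjoint (allV k) f (λ v → level v ≤? m) (inBand? m) (λ v → level v ≤? suc (suc m))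
    (λ {v} lv≤m band → <⇒≱ (≤-trans (proj₁ band) (column≤level v)) lv≤m)
    (λ lv≤m → ≤-trans lv≤m (m≤n+m m 2))
    proj₂

  -- The rung a band vertex z is centred on: rung t lies at distance |t - center|
  -- from it, where center is its height in column m+1 and one less in column m+2.
  center : ℕ → V k → ℕ
  center m z = height z + suc m ∸ column z

  reaches : ℕ → V k → ℕ → ℕ
  reaches m z t = (1 if inInterval? (center m z ∸ f z) (center m z + f z) t)
                    if (inBand? m z ×-dec (1 ≤? f z))

  -- a band vertex of strength r ≥ 1 reaches at most 2r + 1 ≤ 3r rungs
  reaches-count : ∀ N m z → sumOf (downFrom N) (reaches m z) ≤ 3 * (f z if inBand? m z)
  reaches-count N m z with inBand? m z ×-dec (1 ≤? f z)
  ... | yes (band , f[z]≥1) = begin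
    sumOf (downFrom N) (λ t → 1 if inInterval? (c ∸ r) (c + r) t) ≤⟨ intervalCount N (c ∸ r) (c + r) ⟩
    suc (c + r) ∸ (c ∸ r)                                       ≤⟨ intervalWidth c r ⟩
    suc (r + r)                                                 ≤⟨ 1+2r≤3r f[z]≥1 ⟩
    3 * r                                                       ≡⟨ cong (3 *_) (sym (if-yes band (inBand? m z))) ⟩
    3 * (r if inBand? m z)                                      ∎
    where
    open ≤-Reasoning
    c = center m z
    r = f z
  ... | no _ = ≤-trans (≤-reflexive (sumOf-zero (downFrom N))) z≤n

  active-reaches : ∀ {m t} z → InBand m z → 0 < f z → ∣ t - center m z ∣ ≤ f z → reaches m z t ≡ 1
  active-reaches {m} {t} z band f[z]>0 close =
    trans (if-yes (band , f[z]>0) (inBand? m z ×-dec (1 ≤? f z)))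
          (if-yes (ball⇒interval close) (inInterval? (center m z ∸ f z) (center m z + f z) t))

  resolverX-reaches : ∀ {m t} z → 0 < f z → column z ≡ suc m → ∣ t - height z ∣ ≤ f z →
                      reaches m z t ≡ 1
  resolverX-reaches {m} {t} z f[z]>0 cz close = active-reaches z band f[z]>0 close′
    where
    band : InBand m z
    band = ≤-reflexive (sym cz) , ≤-trans (level≤1+column z) (≤-reflexive (cong suc cz))
    close′ : ∣ t - center m z ∣ ≤ f z
    close′ rewrite cz | m+n∸n≡m (height z) (suc m) = close

  resolverY-reaches : ∀ {m t h′} z → 0 < f z → column z ≡ suc (suc m) → height z ≡ suc h′ →
                      ∣ t - h′ ∣ ≤ f z → reaches m z t ≡ 1
  resolverY-reaches {m} {t} {h′} z f[z]>0 cz hz close = active-reaches z band f[z]>0 close′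
    where
    band : InBand m z
    band = ≤-trans (n≤1+n (suc m)) (≤-reflexive (sym cz)) , ≤-reflexive (trans (level-offSpine z hz) cz)
    close′ : ∣ t - center m z ∣ ≤ f z
    close′ rewrite cz | hz | m+n∸n≡m h′ (suc m) = close

  reachedFromBand : ∀ {m t} z → reaches m z t ≡ 1 → 1 ≤ sumOf (allV k) (λ z → reaches m z t)
  reachedFromBand {m} {t} z r≡1 =
    ≤-trans (≤-reflexive (sym r≡1)) (sumOf-point (λ z → reaches m z t) (allV-complete z))

  module _ (resolving : Resolving k f) where

    -- A vertex in the columns ≤ m that does not reach along the spine to column
    -- 2(m+2) - 13 can only resolve the rungs t ≤ (m+2) - 13; each other rung
    -- t < m+2 is reached from the band.
    rung-covered : ∀ m t → suc (suc m) ≤ k → t < suc (suc m) →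
                   (∀ z → column z ≤ m → f z + column z + 13 < 2 * suc (suc m) + height z) →
                   1 ≤ 1 if inInterval? 0 (suc (suc m) ∸ 13) t + sumOf (allV k) (λ z → reaches m z t)
    rung-covered m t m+2≤k t<m+2 weak with rungResolved f resolving m t m+2≤k (s≤s⁻¹ t<m+2)
    ... | z , _ , before a≤m reach =
      ≤-trans (≤-reflexive (sym (if-yes (z≤n , early⇒lowRung reach (weak z a≤m) a≤m)
                                        (inInterval? 0 (suc (suc m) ∸ 13) t))))
              (m≤m+n _ _)
    ... | z , f[z]>0 , inColumnX cz close =
      ≤-trans (reachedFromBand z (resolverX-reaches z f[z]>0 cz close)) (m≤n+m _ _)
    ... | z , f[z]>0 , inColumnY cz h′ hz close =
      ≤-trans (reachedFromBand z (resolverY-reaches z f[z]>0 cz hz close)) (m≤n+m _ _)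

    -- Under the same hypothesis, summing over the n = m+2 rungs: at most n - 12 of
    -- them are low, and the band reaches at most 3 · bandCost m of them, so
    -- bandCost m ≥ 4.
    band-pays : ∀ m → suc (suc m) ≤ k → 13 ≤ suc (suc m) →
                (∀ z → column z ≤ m → f z + column z + 13 < 2 * suc (suc m) + height z) →
                4 ≤ bandCost m
    band-pays m m+2≤k 13≤n weak = covered⇒4≤c (begin
      n                                                  ≡⟨ sym (count-downFrom n) ⟩
      sumOf (downFrom n) (λ _ → 1)                       ≤⟨ sumOf-mono (downFrom n) (λ t∈ →
                                                              rung-covered m _ m+2≤k (∈-downFrom⁻ t∈) weak) ⟩
      sumOf (downFrom n) (λ t → low t + reachedBy t)     ≡⟨ sumOf-+ (downFrom n) low reachedBy ⟩
      sumOf (downFrom n) low + sumOf (downFrom n) reachedBy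
                                                         ≡⟨ cong (sumOf (downFrom n) low +_)
                                                              (sumOf-comm (downFrom n) (allV k) (λ t z → reaches m z t)) ⟩
      sumOf (downFrom n) low + sumOf (allV k) (λ z → sumOf (downFrom n) (reaches m z))
                                                         ≤⟨ +-mono-≤ (intervalCount n 0 (n ∸ 13))
                                                              (sumOf-mono (allV k) (λ {z} _ → reaches-count n m z)) ⟩
      suc (n ∸ 13) + sumOf (allV k) (λ z → 3 * (f z if inBand? m z))
                                                         ≡⟨ cong (suc (n ∸ 13) +_) (sumOf-* (allV k) 3 (λ z → f z if inBand? m z)) ⟩
      suc (n ∸ 13) + 3 * bandCost m                      ∎) 13≤n
      where
      open ≤-Reasoning
      n = suc (suc m)
      low : ℕ → ℕ
      low t = 1 if inInterval? 0 (n ∸ 13) t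
      reachedBy : ℕ → ℕ
      reachedBy t = sumOf (allV k) (λ z → reaches m z t)

    -- Paid: their broadcast has total
    -- strength at least 2n - 40.  Compensated: no vertex among them reaches along
    -- the spine (to column `column z + f z - height z`) beyond costUpTo n + 24.
    Paid : ℕ → Set
    Paid n = 2 * n ≤ costUpTo n + 40

    Compensated : ℕ → Set
    Compensated n = ∀ z → level z ≤ n → f z + column z ≤ costUpTo n + 24 + height z

    Strong : ℕ → V k → Set
    Strong m z = column z ≤ m × 2 * suc (suc m) + height z ≤ f z + column z + 13

    strong? : ∀ m z → Dec (Strong m z)
    strong? m z = (column z ≤? m) ×-dec (2 * suc (suc m) + height z ≤? f z + column z + 13)

    paid-small : ∀ n → n ≤ 20 → Paid n
    paid-small n n≤20 = ≤-trans (*-monoʳ-≤ 2 n≤20) (m≤n+m 40 (costUpTo n))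

    compensated-small : ∀ n → n ≤ 24 → Compensated n
    compensated-small n n≤24 z lz =
      ≤-trans (+-mono-≤ (costUpTo-point z lz) (≤-trans (column≤level z) (≤-trans lz n≤24)))
              (m≤m+n (costUpTo n + 24) (height z))

    -- Levels m+1, m+2 pay for 4 more (m + 2 ≥ 21): a strong vertex of level ≤ m
    -- is compensated, so it already pays for 2(m+2); a strong vertex of level
    -- m+1 has strength ≥ 4 on top of costUpTo m; without strong vertices, the
    -- band pays ≥ 4.
    gain-4 : ∀ m → suc (suc m) ≤ k → 21 ≤ suc (suc m) → Compensated m →
             2 * m ≤ costUpTo m + 40 → 2 * suc (suc m) ≤ costUpTo (suc (suc m)) + 40
    gain-4 m m+2≤k 21≤n compensated paid with any? (strong? m) (allV k)
    ... | yes someStrong with satisfied someStrong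
    ...   | z , (cz≤m , strong) with level z ≤? m
    ...     | yes lz≤m = ≤-trans (strong⇒paid {n = suc (suc m)} {f = f z} {a = column z} (compensated z lz≤m) strong)
                                 (+-mono-≤ (costUpTo-mono (m≤n+m m 2)) (m≤m+n 37 3))
    ...     | no  lz≰m = paid-by-4 paid (≤-trans (+-monoʳ-≤ (costUpTo m) 4≤fz)
                                                 (costUpTo-extend z (≰⇒> lz≰m) lz≤m+2))
      where
      4≤fz : 4 ≤ f z
      4≤fz = strong⇒4≤f cz≤m strong (s≤s⁻¹ (s≤s⁻¹ 21≤n))
      lz≤m+2 : level z ≤ suc (suc m)
      lz≤m+2 = ≤-trans (level≤1+column z) (s≤s (≤-trans cz≤m (n≤1+n m)))
    gain-4 m m+2≤k 21≤n compensated paid | no noneStrong =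
      paid-by-4 paid (≤-trans (+-monoʳ-≤ (costUpTo m) band≥4) (costUpTo-band m))
      where
      weak : ∀ z → column z ≤ m → f z + column z + 13 < 2 * suc (suc m) + height z
      weak z cz≤m = ≰⇒> (λ strong → noneStrong (lose (allV-complete z) (cz≤m , strong)))
      band≥4 : 4 ≤ bandCost m
      band≥4 = band-pays m m+2≤k (≤-trans (m≤m+n 13 8) 21≤n) weak

    paid-step : ∀ m → suc (suc m) ≤ k → Paid m → Compensated m → Paid (suc (suc m))
    paid-step m m+2≤k paid compensated with suc (suc m) ≤? 20
    ... | yes n≤20 = paid-small (suc (suc m)) n≤20
    ... | no  n≰20 = gain-4 m m+2≤k (≰⇒> n≰20) compensated paid

    -- two more levels: old vertices stay compensated, new ones are paid on top
    compensated-step : ∀ m → Paid m → Compensated m → Compensated (suc (suc m))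
    compensated-step m paid compensated z lz with suc (suc m) ≤? 24
    ... | yes n≤24 = compensated-small (suc (suc m)) n≤24 z lz
    ... | no  n≰24 with level z ≤? m
    ...   | yes lz≤m = ≤-trans (compensated z lz≤m)
                               (+-monoˡ-≤ (height z) (+-monoˡ-≤ 24 (costUpTo-mono (m≤n+m m 2))))
    ...   | no  lz≰m = compensated-new paid (costUpTo-extend z (≰⇒> lz≰m) lz)
                         (≤-trans (column≤level z) lz) (s≤s⁻¹ (s≤s⁻¹ (≰⇒> n≰24)))

    invariants : ∀ n → n ≤ k → Paid n × Compensated n
    invariants zero          _   = paid-small 0 z≤n , compensated-small 0 z≤n
    invariants (suc zero)    _   = paid-small 1 (s≤s z≤n) , compensated-small 1 (s≤s z≤n)
    invariants (suc (suc m)) n≤k = paid-step m n≤k paid compensated , compensated-step m paid compensated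
      where
      paid×compensated = invariants m (≤-trans (m≤n+m m 2) n≤k)
      paid = proj₁ paid×compensated
      compensated = proj₂ paid×compensated

lemma6p3 : ∃[ C ] ((k : ℕ) → (f : V k → ℕ) → Resolving k f → k ≤ f (vk k) →
             f (vk k) + 2 * k ≤ cost k f + C)
lemma6p3 = 40 , bound
  where
  bound : (k : ℕ) → (f : V k → ℕ) → Resolving k f → k ≤ f (vk k) → f (vk k) + 2 * k ≤ cost k f + 40
  bound k f resolving _ = begin
    f (vk k) + 2 * k              ≤⟨ +-monoʳ-≤ (f (vk k)) (proj₁ (invariants resolving k ≤-refl)) ⟩
    f (vk k) + (costUpTo k + 40)  ≡⟨ sym (+-assoc (f (vk k)) (costUpTo k) 40) ⟩
    f (vk k) + costUpTo k + 40    ≡⟨ cong (_+ 40) (+-comm (f (vk k)) (costUpTo k)) ⟩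
    costUpTo k + f (vk k) + 40    ≤⟨ +-monoˡ-≤ 40 (costUpTo-extend (vk k) (≤-reflexive (sym level-vk))
                                                                       (≤-reflexive level-vk)) ⟩
    costUpTo (suc k) + 40         ≤⟨ +-monoˡ-≤ 40 (costUpTo≤cost (suc k)) ⟩
    cost k f + 40                 ∎
    where
    open ≤-Reasoning
    open Broadcast f
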